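{- Let $\mathcal W$ be a category with terminal object $\top$, $U\in\mathcal W$, and $-\ltimes U:\mathcal W\to\mathcal W$ an endomultiplier for $U$ that is both 3/4-cartesian and affine. Then $U$ is a terminal object. If the multiplier is moreover cartesian, then it is naturally isomorphic to the identity functor.
   Context: An (endo)multiplier for $U$ is a functor $-\ltimes U:\mathcal W\to\mathcal W$ with an isomorphism $\top\ltimes U\cong U$; $\pi_2:W\ltimes U\to U$ is $(!_W\ltimes U)$ followed by it. $\mathrm{Fr}_U:\mathcal W\to\mathcal W/U$, $W\mapsto(W\ltimes U,\pi_2)$, $f\mapsto f\ltimes U$; the multiplier is affine if $\mathrm{Fr}_U$ is full. It is 3/4-cartesian if there are natural transformations $\pi_1:W\ltimes U\to W$ and $\delta_W:W\ltimes U\to(W\ltimes U)\ltimes U$ making $(-\ltimes U,\pi_1,\delta)$ a comonad (in particular $\pi_{1,W\ltimes U}\circ\delta_W=\mathrm{id}$ and $(\pi_{1,W}\ltimes U)\circ\delta_W=\mathrm{id}$). It is cartesian if it is naturally isomorphic to $-\times U$. -}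

module Defs where

open import Level using (Level; _⊔_; suc)
open import Data.Product using (Σ; Σ-syntax; _×_; _,_)
open import Relation.Binary using (IsEquivalence)

record Category (o ℓ e : Level) : Set (suc (o ⊔ ℓ ⊔ e)) where
  infixr 9 _∘_
  infix  4 _≈_
  field
    Obj   : Set o
    Hom   : Obj → Obj → Set ℓ
    _≈_   : ∀ {A B} → Hom A B → Hom A B → Set e
    id    : ∀ {A} → Hom A A
    _∘_   : ∀ {A B C} → Hom B C → Hom A B → Hom A C
    equiv : ∀ {A B} → IsEquivalence (_≈_ {A} {B})
    assoc : ∀ {A B C D} {f : Hom A B} {g : Hom B C} {h : Hom C D} →
            (h ∘ g) ∘ f ≈ h ∘ (g ∘ f)
    identityˡ : ∀ {A B} {f : Hom A B} → id ∘ f ≈ f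
    identityʳ : ∀ {A B} {f : Hom A B} → f ∘ id ≈ f
    ∘-resp-≈  : ∀ {A B C} {f h : Hom B C} {g i : Hom A B} →
                f ≈ h → g ≈ i → f ∘ g ≈ h ∘ i

module _ {o ℓ e : Level} (C : Category o ℓ e) where
  open Category C

  IsTerminal : Obj → Set (o ⊔ ℓ ⊔ e)
  IsTerminal X = ∀ Y → Σ[ f ∈ Hom Y X ] (∀ (g : Hom Y X) → g ≈ f)

  record Iso (A B : Obj) : Set (ℓ ⊔ e) where
    field
      to   : Hom A B
      from : Hom B A
      isoˡ : from ∘ to ≈ id
      isoʳ : to ∘ from ≈ id

  record Endofunctor : Set (o ⊔ ℓ ⊔ e) where
    field
      F₀ : Obj → Obj
      F₁ : ∀ {A B} → Hom A B → Hom (F₀ A) (F₀ B)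
      identity     : ∀ {A} → F₁ (id {A}) ≈ id
      homomorphism : ∀ {A B C} {f : Hom A B} {g : Hom B C} →
                     F₁ (g ∘ f) ≈ F₁ g ∘ F₁ f
      F-resp-≈     : ∀ {A B} {f g : Hom A B} → f ≈ g → F₁ f ≈ F₁ g

  record ProductWith (U W : Obj) : Set (o ⊔ ℓ ⊔ e) where
    field
      P     : Obj
      p₁    : Hom P W
      p₂    : Hom P U
      pair  : ∀ {X} → Hom X W → Hom X U → Hom X P
      project₁ : ∀ {X} {f : Hom X W} {g : Hom X U} → p₁ ∘ pair f g ≈ f
      project₂ : ∀ {X} {f : Hom X W} {g : Hom X U} → p₂ ∘ pair f g ≈ g
      unique   : ∀ {X} {h : Hom X P} {f : Hom X W} {g : Hom X U} →
                 p₁ ∘ h ≈ f → p₂ ∘ h ≈ g → pair f g ≈ h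

module _ {o ℓ e : Level} {C : Category o ℓ e} where
  open Category C

  record NatIso (F G : Endofunctor C) : Set (o ⊔ ℓ ⊔ e) where
    open Endofunctor F renaming (F₀ to F₀; F₁ to F₁)
    open Endofunctor G renaming (F₀ to G₀; F₁ to G₁)
    field
      iso     : ∀ W → Iso C (F₀ W) (G₀ W)
      natural : ∀ {A B} (f : Hom A B) →
                Iso.to (iso B) ∘ F₁ f ≈ G₁ f ∘ Iso.to (iso A)

  idF : Endofunctor C
  idF = record
    { F₀ = λ X → X ; F₁ = λ f → f
    ; identity = IsEquivalence.refl equiv
    ; homomorphism = IsEquivalence.refl equiv
    ; F-resp-≈ = λ p → p }

module _ {o ℓ e : Level} (C : Category o ℓ e) (⊤ : Category.Obj C)
         (⊤-terminal : IsTerminal C ⊤) (U : Category.Obj C) where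
  open Category C

  ! : ∀ (W : Obj) → Hom W ⊤
  ! W = Σ.proj₁ (⊤-terminal W) where open import Data.Product as Σ using ()

  record Multiplier : Set (o ⊔ ℓ ⊔ e) where
    field
      ⋉U   : Endofunctor C
      unit : Iso C (Endofunctor.F₀ ⋉U ⊤) U
    open Endofunctor ⋉U public

    π₂ : ∀ W → Hom (F₀ W) U
    π₂ W = Iso.to unit ∘ F₁ (! W)

  module _ (M : Multiplier) where
    open Multiplier M

    -- Affine: Fr_U : W → W/U, W ↦ (W ⋉ U, π₂), f ↦ f ⋉ U, is full.
    -- Unfolded: every slice morphism f : (W ⋉ U, π₂) → (W' ⋉ U, π₂)
    -- (i.e. π₂ ∘ f ≈ π₂) is (≈) of the form g ⋉ U.
    Affine : Set (o ⊔ ℓ ⊔ e)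
    Affine = ∀ {W W'} (f : Hom (F₀ W) (F₀ W')) → π₂ W' ∘ f ≈ π₂ W →
             Σ[ g ∈ Hom W W' ] F₁ g ≈ f

    -- 3/4-cartesian: natural π₁ : - ⋉ U ⇒ Id and δ : - ⋉ U ⇒ (- ⋉ U) ⋉ U
    -- making (- ⋉ U, π₁, δ) a comonad.
    record ThreeQuarterCartesian : Set (o ⊔ ℓ ⊔ e) where
      field
        π₁ : ∀ W → Hom (F₀ W) W
        δ  : ∀ W → Hom (F₀ W) (F₀ (F₀ W))
        π₁-natural : ∀ {A B} (f : Hom A B) → f ∘ π₁ A ≈ π₁ B ∘ F₁ f
        δ-natural  : ∀ {A B} (f : Hom A B) → F₁ (F₁ f) ∘ δ A ≈ δ B ∘ F₁ f
        counitˡ : ∀ W → π₁ (F₀ W) ∘ δ W ≈ id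
        counitʳ : ∀ W → F₁ (π₁ W) ∘ δ W ≈ id
        coassoc : ∀ W → δ (F₀ W) ∘ δ W ≈ F₁ (δ W) ∘ δ W

    -- Cartesian: products W × U exist and - ⋉ U is naturally isomorphic
    -- to the functor - × U (acting on f by f × U = pair (f ∘ p₁) p₂).
    record Cartesian : Set (o ⊔ ℓ ⊔ e) where
      field
        prod : ∀ W → ProductWith C U W
      open ProductWith
      field
        iso     : ∀ W → Iso C (F₀ W) (P (prod W))
        natural : ∀ {A B} (f : Hom A B) →
                  Iso.to (iso B) ∘ F₁ f
                    ≈ pair (prod B) (f ∘ p₁ (prod A)) (p₂ (prod A)) ∘ Iso.to (iso A)

-- Since maps into ⊤ are unique, the counit law F₁ (π₁ W) ∘ δ W ≈ id shows that δ W is a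
-- morphism over U from (W ⋉ U, π₂) to ((W ⋉ U) ⋉ U, π₂).  Affineness writes it as g ⋉ U,
-- and then naturality of π₁ and the other counit law give g ∘ π₁ W ≈ id: every W ⋉ U is a
-- retract of W.  A retract of a terminal object is terminal, so ⊤ ⋉ U ≅ U is terminal.
-- Once U is terminal, W × U ≅ W via the first projection, which turns a natural
-- isomorphism - ⋉ U ≅ - × U into one with the identity functor.
module Submission where

open import Defs
open import Level using (Level; _⊔_)
open import Data.Product using (_×_; _,_; proj₁; proj₂; Σ-syntax)
open import Relation.Binary using (IsEquivalence; Setoid)
import Relation.Binary.Reasoning.Setoid as SetoidReasoning

module CategoryFacts {o ℓ e : Level} (C : Category o ℓ e) where
  open Category C
  module ≈ {A B} = IsEquivalence (equiv {A} {B})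

  hom-setoid : Obj → Obj → Setoid ℓ e
  hom-setoid A B = record { Carrier = Hom A B ; _≈_ = _≈_ ; isEquivalence = equiv }

  module HomReasoning {A B : Obj} = SetoidReasoning (hom-setoid A B)

  infixr 4 refl⟩∘⟨_
  infixl 5 _⟩∘⟨refl

  refl⟩∘⟨_ : ∀ {A B D} {f : Hom B D} {g h : Hom A B} → g ≈ h → f ∘ g ≈ f ∘ h
  refl⟩∘⟨ p = ∘-resp-≈ ≈.refl p

  _⟩∘⟨refl : ∀ {A B D} {f g : Hom B D} {h : Hom A B} → f ≈ g → f ∘ h ≈ g ∘ h
  p ⟩∘⟨refl = ∘-resp-≈ p ≈.refl

  cancelInner : ∀ {A B D E} {h : Hom D E} {f : Hom B D} {g : Hom D B} {k : Hom A D} →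
                f ∘ g ≈ id → (h ∘ f) ∘ (g ∘ k) ≈ h ∘ k
  cancelInner {h = h} {f} {g} {k} fg≈id = begin
    (h ∘ f) ∘ (g ∘ k)  ≈⟨ assoc ⟩
    h ∘ (f ∘ (g ∘ k))  ≈⟨ refl⟩∘⟨ ≈.sym assoc ⟩
    h ∘ ((f ∘ g) ∘ k)  ≈⟨ refl⟩∘⟨ fg≈id ⟩∘⟨refl ⟩
    h ∘ (id ∘ k)       ≈⟨ refl⟩∘⟨ identityˡ ⟩
    h ∘ k              ∎
    where open HomReasoning

  terminal-unique : ∀ {T X} → IsTerminal C T → (f g : Hom X T) → f ≈ g
  terminal-unique {X = X} T-terminal f g =
    ≈.trans (proj₂ (T-terminal X) f) (≈.sym (proj₂ (T-terminal X) g))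

  record Retract (A B : Obj) : Set (ℓ ⊔ e) where
    field
      section    : Hom A B
      retraction : Hom B A
      retract    : retraction ∘ section ≈ id

  Iso⇒Retract : ∀ {A B} → Iso C A B → Retract B A
  Iso⇒Retract i = record
    { section = Iso.from i ; retraction = Iso.to i ; retract = Iso.isoʳ i }

  Retract-trans : ∀ {A B D} → Retract A B → Retract B D → Retract A D
  Retract-trans r₁ r₂ = record
    { section    = Retract.section r₂ ∘ Retract.section r₁
    ; retraction = Retract.retraction r₁ ∘ Retract.retraction r₂
    ; retract    = ≈.trans (cancelInner (Retract.retract r₂)) (Retract.retract r₁)
    }

  Retract-IsTerminal : ∀ {A T} → Retract A T → IsTerminal C T → IsTerminal C A
  Retract-IsTerminal {A} {T} r T-terminal X = retraction ∘ !T X , is-unique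
    where
    open Retract r
    !T : ∀ X → Hom X T
    !T X = proj₁ (T-terminal X)
    is-unique : (h : Hom X A) → h ≈ retraction ∘ !T X
    is-unique h = begin
      h                            ≈⟨ ≈.sym identityˡ ⟩
      id ∘ h                       ≈⟨ ≈.sym retract ⟩∘⟨refl ⟩
      (retraction ∘ section) ∘ h   ≈⟨ assoc ⟩
      retraction ∘ (section ∘ h)   ≈⟨ refl⟩∘⟨ terminal-unique T-terminal _ _ ⟩
      retraction ∘ !T X            ∎
      where open HomReasoning

  Iso-trans : ∀ {A B D} → Iso C A B → Iso C B D → Iso C A D
  Iso-trans i j = record
    { to   = Iso.to j ∘ Iso.to i
    ; from = Iso.from i ∘ Iso.from j
    ; isoˡ = ≈.trans (cancelInner (Iso.isoˡ j)) (Iso.isoˡ i)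
    ; isoʳ = ≈.trans (cancelInner (Iso.isoʳ i)) (Iso.isoʳ j)
    }

  module _ {U W : Obj} (Pr : ProductWith C U W) where
    open ProductWith Pr

    ProductWith-jointly-monic : ∀ {X} {h k : Hom X P} →
                                p₁ ∘ h ≈ p₁ ∘ k → p₂ ∘ h ≈ p₂ ∘ k → h ≈ k
    ProductWith-jointly-monic eq₁ eq₂ = ≈.trans (≈.sym (unique eq₁ eq₂)) (unique ≈.refl ≈.refl)

    ProductWith-terminal-Iso : IsTerminal C U → Iso C P W
    ProductWith-terminal-Iso U-terminal = record
      { to   = p₁
      ; from = pair id (proj₁ (U-terminal W))
      ; isoˡ = ProductWith-jointly-monic p₁-eq (terminal-unique U-terminal _ _)
      ; isoʳ = project₁
      }
      where
      open HomReasoning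
      p₁-eq : p₁ ∘ (pair id (proj₁ (U-terminal W)) ∘ p₁) ≈ p₁ ∘ id
      p₁-eq = begin
        p₁ ∘ (pair id _ ∘ p₁)   ≈⟨ ≈.sym assoc ⟩
        (p₁ ∘ pair id _) ∘ p₁   ≈⟨ project₁ ⟩∘⟨refl ⟩
        id ∘ p₁                 ≈⟨ identityˡ ⟩
        p₁                      ≈⟨ ≈.sym identityʳ ⟩
        p₁ ∘ id                 ∎

module MultiplierFacts {o ℓ e : Level} (C : Category o ℓ e) (⊤ : Category.Obj C)
    (⊤-terminal : IsTerminal C ⊤) (U : Category.Obj C)
    (M : Multiplier C ⊤ ⊤-terminal U) where
  open Category C
  open CategoryFacts C
  open Multiplier M

  !⊤ : ∀ W → Hom W ⊤
  !⊤ = ! C ⊤ ⊤-terminal U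

  module _ (TQ : ThreeQuarterCartesian C ⊤ ⊤-terminal U M) where
    open ThreeQuarterCartesian TQ

    δ-over-U : ∀ W → π₂ (F₀ W) ∘ δ W ≈ π₂ W
    δ-over-U W = begin
      (Iso.to unit ∘ F₁ (!⊤ (F₀ W))) ∘ δ W          ≈⟨ assoc ⟩
      Iso.to unit ∘ (F₁ (!⊤ (F₀ W)) ∘ δ W)          ≈⟨ refl⟩∘⟨ F-resp-≈ !-factors ⟩∘⟨refl ⟩
      Iso.to unit ∘ (F₁ (!⊤ W ∘ π₁ W) ∘ δ W)        ≈⟨ refl⟩∘⟨ homomorphism ⟩∘⟨refl ⟩
      Iso.to unit ∘ ((F₁ (!⊤ W) ∘ F₁ (π₁ W)) ∘ δ W) ≈⟨ refl⟩∘⟨ assoc ⟩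
      Iso.to unit ∘ (F₁ (!⊤ W) ∘ (F₁ (π₁ W) ∘ δ W)) ≈⟨ refl⟩∘⟨ refl⟩∘⟨ counitʳ W ⟩
      Iso.to unit ∘ (F₁ (!⊤ W) ∘ id)                ≈⟨ refl⟩∘⟨ identityʳ ⟩
      Iso.to unit ∘ F₁ (!⊤ W)                       ∎
      where
      open HomReasoning
      !-factors : !⊤ (F₀ W) ≈ !⊤ W ∘ π₁ W
      !-factors = terminal-unique ⊤-terminal _ _

    ⋉U-Retract : Affine C ⊤ ⊤-terminal U M → ∀ W → Retract (F₀ W) W
    ⋉U-Retract affine W = record
      { section = π₁ W ; retraction = g ; retract = g∘π₁≈id }
      where
      δ-lifts : Σ[ g ∈ Hom W (F₀ W) ] F₁ g ≈ δ W
      δ-lifts = affine (δ W) (δ-over-U W)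
      g : Hom W (F₀ W)
      g = proj₁ δ-lifts
      g∘π₁≈id : g ∘ π₁ W ≈ id
      g∘π₁≈id = begin
        g ∘ π₁ W              ≈⟨ π₁-natural g ⟩
        π₁ (F₀ W) ∘ F₁ g      ≈⟨ refl⟩∘⟨ proj₂ δ-lifts ⟩
        π₁ (F₀ W) ∘ δ W       ≈⟨ counitˡ W ⟩
        id                    ∎
        where open HomReasoning

  Cartesian⇒≅idF : IsTerminal C U → Cartesian C ⊤ ⊤-terminal U M → NatIso ⋉U idF
  Cartesian⇒≅idF U-terminal cartesian = record { iso = iso≅id ; natural = natural≅id }
    where
    open Cartesian cartesian
    open ProductWith

    iso≅id : ∀ W → Iso C (F₀ W) W
    iso≅id W = Iso-trans (iso W) (ProductWith-terminal-Iso (prod W) U-terminal)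

    natural≅id : ∀ {A B} (f : Hom A B) → Iso.to (iso≅id B) ∘ F₁ f ≈ f ∘ Iso.to (iso≅id A)
    natural≅id {A} {B} f = begin
      (p₁ (prod B) ∘ Iso.to (iso B)) ∘ F₁ f                                   ≈⟨ assoc ⟩
      p₁ (prod B) ∘ (Iso.to (iso B) ∘ F₁ f)                                   ≈⟨ refl⟩∘⟨ natural f ⟩
      p₁ (prod B) ∘ (pair (prod B) (f ∘ p₁ (prod A)) _ ∘ Iso.to (iso A))      ≈⟨ ≈.sym assoc ⟩
      (p₁ (prod B) ∘ pair (prod B) (f ∘ p₁ (prod A)) _) ∘ Iso.to (iso A)      ≈⟨ project₁ (prod B) ⟩∘⟨refl ⟩
      (f ∘ p₁ (prod A)) ∘ Iso.to (iso A)                                      ≈⟨ assoc ⟩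
      f ∘ (p₁ (prod A) ∘ Iso.to (iso A))                                      ∎
      where open HomReasoning

mainTheorem6 : {o ℓ e : Level} (C : Category o ℓ e) (⊤ : Category.Obj C)
               (⊤-terminal : IsTerminal C ⊤) (U : Category.Obj C)
               (M : Multiplier C ⊤ ⊤-terminal U) →
               ThreeQuarterCartesian C ⊤ ⊤-terminal U M →
               Affine C ⊤ ⊤-terminal U M →
               IsTerminal C U
               × (Cartesian C ⊤ ⊤-terminal U M →
                  NatIso (Multiplier.⋉U M) idF)
mainTheorem6 C ⊤ ⊤-terminal U M threeQuarter affine = U-terminal , Cartesian⇒≅idF U-terminal
  where
  open CategoryFacts C
  open MultiplierFacts C ⊤ ⊤-terminal U M

  U-terminal : IsTerminal C U
  U-terminal = Retract-IsTerminal
    (Retract-trans (Iso⇒Retract (Multiplier.unit M)) (⋉U-Retract threeQuarter affine ⊤))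
    ⊤-terminal
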